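{- For every system $\mathcal{S}=(S,\{0,1\}^X)$: (1) $\mathrm{str}(\mathcal{S})=\mathrm{set}\big(\bigcup\{Q(\mathcal{S}) : Q\in\mathrm{fshift}(X)\}\big)$; (2) $\mathrm{sstr}(\mathcal{S})=\mathrm{set}\big(\bigcap\{Q(\mathcal{S}) : Q\in\mathrm{fshift}(X)\}\big)$, where the union (intersection) of systems on the same ground set $\{0,1\}^X$ is the system whose set is the union (intersection) of their sets.
   Context: A system is a pair $\mathcal{S}=(S,\{0,1\}^X)$ with $X$ finite and $S\subseteq\{0,1\}^X$. For disjoint $A,B$ and $f\in\{0,1\}^A,g\in\{0,1\}^B$, $g\star f$ is their common extension to $A\cup B$. $\mathcal{S}$ shatters $Y\subseteq X$ if $\forall f\in\{0,1\}^Y\ \exists g\in\{0,1\}^{X\setminus Y}: g\star f\in S$; it strongly shatters $Y$ if $\exists g\in\{0,1\}^{X\setminus Y}\ \forall f\in\{0,1\}^Y: g\star f\in S$; $\mathrm{str}(\mathcal{S})$ and $\mathrm{sstr}(\mathcal{S})$ are the families of shattered and strongly shattered subsets of $X$. $\mathrm{set}(\mathcal{S})=\{f^{ -1}(1): f\in S\}$. Down-shifting on $x\in X$: $D_x(\mathcal{S})$ is the system on $\{0,1\}^X$ obtained as follows: for every pair $u',u''\in\{0,1\}^X$ differing only at $x$ with $u'(x)=0,u''(x)=1$, the new set contains $u'$ iff at least one of $u',u''$ is in $S$, and contains $u''$ iff both are in $S$. $\mathrm{fshift}(X)$ is the set of all sequences in which each operator $D_x$, $x\in X$, appears exactly once;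 for a sequence $Q$, $Q(\mathcal{S})$ is the result of applying its operators to $\mathcal{S}$ one after the other. -}

module Defs where

open import Data.Nat using (ℕ)
open import Data.Bool using (Bool; true; false; if_then_else_; _∧_; _∨_)
open import Data.Fin using (Fin)
open import Data.Fin.Subset using (Subset)
open import Data.Vec using (Vec; lookup; tabulate; _[_]≔_)
open import Data.List using (List; []; _∷_; allFin)
open import Data.List.Relation.Binary.Permutation.Propositional using (_↭_)
open import Data.Product using (Σ; _×_; ∃)
open import Relation.Binary.PropositionalEquality using (_≡_)

-- The ground set X is Fin n.  An element of {0,1}^X is a vector Vec Bool n.
Point : ℕ → Set
Point n = Vec Bool n

System : ℕ → Set
System n = Point n → Bool

-- A (not necessarily decidable) system, used for unions/intersections of systems.
SystemP : ℕ → Set₁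
SystemP n = Point n → Set

_∈S_ : ∀ {n} → Point n → System n → Set
u ∈S S = S u ≡ true

-- g ⋆ f for f ∈ {0,1}^Y, g ∈ {0,1}^(X∖Y): both are represented by full vectors,
-- of which only the coordinates in Y (for f), resp. outside Y (for g), are used.
star : ∀ {n} → Subset n → (g f : Point n) → Point n
star Y g f = tabulate (λ i → if lookup Y i then lookup f i else lookup g i)

Shatters : ∀ {n} → System n → Subset n → Set
Shatters S Y = ∀ (f : Point _) → ∃ λ (g : Point _) → star Y g f ∈S S

StronglyShatters : ∀ {n} → System n → Subset n → Set
StronglyShatters S Y = ∃ λ (g : Point _) → ∀ (f : Point _) → star Y g f ∈S S

-- f ↦ f⁻¹(1) : since Subset n = Vec Bool n (true = member), this is the identity.
ones : ∀ {n} → Point n → Subset n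
ones f = tabulate (λ i → lookup f i)

InSet : ∀ {n} → SystemP n → Subset n → Set
InSet T Y = ∃ λ f → T f × ones f ≡ Y

down : ∀ {n} → Fin n → System n → System n
down x S u with lookup u x
... | false = S u ∨ S (u [ x ]≔ true)
... | true  = S u ∧ S (u [ x ]≔ false)

applyShifts : ∀ {n} → List (Fin n) → System n → System n
applyShifts []      S = S
applyShifts (x ∷ Q) S = applyShifts Q (down x S)

-- Q ∈ fshift(X): each D_x, x ∈ X, appears exactly once
FShift : (n : ℕ) → List (Fin n) → Set
FShift n Q = Q ↭ allFin n

unionShifts : ∀ {n} → System n → SystemP n
unionShifts {n} S u = ∃ λ Q → FShift n Q × u ∈S applyShifts Q S

interShifts : ∀ {n} → System n → SystemP n
interShifts {n} S u = ∀ Q → FShift n Q → u ∈S applyShifts Q S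

-- Every down-shift D_x can only destroy shattered sets and can only create strongly
-- shattered ones, and after all coordinates have been shifted the system is hereditary;
-- in a hereditary system T a set Y is shattered iff it is strongly shattered iff Y ∈ T.
-- This gives the inclusions str(S) ⊇ set(⋃ Q(S)) and sstr(S) ⊆ set(⋂ Q(S)).  For the
-- reverse inclusions fix Y.  Shifting first the coordinates off Y keeps Y shattered and
-- makes the system down-closed off Y, hence strongly shattering Y, so Y survives the
-- remaining shifts.  If Y survives the order that shifts the coordinates in Y first, some
-- point v ≥ Y survives those first shifts; being 1 on Y, v certifies that its whole Y-cube
-- was already in S.
module Submission where

open import Defs
open import Data.Nat using (ℕ)
open import Data.Fin.Subset using (Subset)
open import Data.Bool using (Bool; true; false; if_then_else_; _∧_; _∨_; _≤_; b≤b; f≤t)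
open import Data.Bool.Properties
  using (∧-conicalˡ; ∧-conicalʳ; ∨-zeroʳ; ¬-not; not-¬; ≤-refl; ≤-trans; ≤-minimum; ≤-maximum)
  renaming (_≟_ to _≟ᵇ_)
open import Data.Empty using (⊥-elim)
open import Data.Fin using (Fin; _≟_)
open import Data.List using (List; []; _∷_; _++_; filter; allFin)
open import Data.List.Properties using (partition-defn)
open import Data.List.Membership.Propositional using (_∈_)
open import Data.List.Membership.Propositional.Properties using (∈-allFin; ∈-filter⁺; ∈-filter⁻)
open import Data.List.Relation.Unary.Any using (here; there)
open import Data.List.Relation.Binary.Permutation.Propositional using (_↭_; ↭-trans; ↭-sym; ↭ₛ⇒↭)
open import Data.List.Relation.Binary.Permutation.Propositional.Properties using (++-comm; ∈-resp-↭)
import Data.List.Relation.Binary.Permutation.Setoid.Properties as ↭ₛ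
open import Data.Product using (_×_; ∃; ∃-syntax; _,_; proj₂)
open import Data.Sum using (_⊎_; inj₁; inj₂)
open import Data.Vec using (lookup; _[_]≔_)
open import Data.Vec.Properties
  using (lookup∘update; lookup∘update′; lookup∘tabulate; tabulate∘lookup; tabulate-cong;
         []≔-idempotent; []≔-commutes; []≔-lookup)
open import Function using (_∘_)
open import Function.Bundles using (_⇔_; mk⇔; Equivalence)
open import Function.Properties.Equivalence using () renaming (trans to ⇔-trans)
open import Relation.Binary.PropositionalEquality
  using (_≡_; _≢_; refl; sym; trans; cong; cong₂; subst; setoid)
open import Relation.Nullary using (Dec; yes; no)
open import Relation.Unary.Properties using (∁?)

private
  variable
    n : ℕ
    b c : Bool
    x k : Fin n
    S : System n
    u v w f g : Point n
    Y : Subset n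
    T : System n
    K : List (Fin n)

open Equivalence using (to; from)

infix 4 _≤ₚ_

_≤ₚ_ : Point n → Point n → Set
u ≤ₚ v = ∀ i → lookup u i ≤ lookup v i

AgreeOutside : List (Fin n) → Point n → Point n → Set
AgreeOutside K u v = ∀ i → lookup u i ≡ lookup v i ⊎ i ∈ K

lookup-ext : (∀ i → lookup u i ≡ lookup v i) → u ≡ v
lookup-ext {u = u} {v = v} eq =
  trans (sym (tabulate∘lookup u)) (trans (tabulate-cong eq) (tabulate∘lookup v))

agreeOutside-[] : AgreeOutside [] u v → u ≡ v
agreeOutside-[] {u = u} {v = v} ag = lookup-ext λ i → agree (ag i)
  where
  agree : ∀ {i} → lookup u i ≡ lookup v i ⊎ i ∈ [] → lookup u i ≡ lookup v i
  agree (inj₁ eq) = eq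

[]≔-self : lookup u x ≡ b → u [ x ]≔ b ≡ u
[]≔-self {u = u} {x = x} refl = []≔-lookup u x

≡-[]≔ : lookup u x ≡ b → (∀ {i} → i ≢ x → lookup u i ≡ lookup v i) → u ≡ v [ x ]≔ b
≡-[]≔ {u = u} {x = x} {b = b} {v = v} at-x off-x = lookup-ext pointwise
  where
  pointwise : ∀ i → lookup u i ≡ lookup (v [ x ]≔ b) i
  pointwise i with i ≟ x
  ... | yes refl = trans at-x (sym (lookup∘update x v b))
  ... | no i≢x   = trans (off-x i≢x) (sym (lookup∘update′ i≢x v b))

≤ₚ-[]≔ : w ≤ₚ u → b ≤ c → w [ k ]≔ b ≤ₚ u [ k ]≔ c
≤ₚ-[]≔ {w = w} {u = u} {b = b} {c = c} {k = k} w≤u b≤c i with i ≟ k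
... | yes refl rewrite lookup∘update k w b | lookup∘update k u c = b≤c
... | no i≢k   rewrite lookup∘update′ i≢k w b | lookup∘update′ i≢k u c = w≤u i

≤ₚ-true : u ≤ₚ v → lookup u x ≡ true → lookup v x ≡ true
≤ₚ-true {x = x} u≤v e = true≤⇒≡true (subst (_≤ _) e (u≤v x))
  where
  true≤⇒≡true : true ≤ b → b ≡ true
  true≤⇒≡true b≤b = refl

agreeOutside-[]≔ : AgreeOutside (k ∷ K) w u → AgreeOutside K (w [ k ]≔ b) (u [ k ]≔ b)
agreeOutside-[]≔ {k = k} {w = w} {u = u} {b = b} ag i with i ≟ k
... | yes refl = inj₁ (trans (lookup∘update k w b) (sym (lookup∘update k u b)))
... | no i≢k with ag i
...   | inj₁ eq          =
  inj₁ (trans (lookup∘update′ i≢k w b) (trans eq (sym (lookup∘update′ i≢k u b))))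
...   | inj₂ (here i≡k)  = ⊥-elim (i≢k i≡k)
...   | inj₂ (there i∈K) = inj₂ i∈K

lookup-star : ∀ i → lookup (star Y g f) i ≡ (if lookup Y i then lookup f i else lookup g i)
lookup-star {Y = Y} {g = g} {f = f} = lookup∘tabulate (λ i → if lookup Y i then lookup f i else lookup g i)

lookup-star-inside : lookup Y x ≡ true → lookup (star Y g f) x ≡ lookup f x
lookup-star-inside {Y = Y} {x = x} {g = g} {f = f} x∈Y
  rewrite lookup-star {Y = Y} {g = g} {f = f} x | x∈Y = refl

lookup-star-outside : lookup Y x ≡ false → lookup (star Y g f) x ≡ lookup g x
lookup-star-outside {Y = Y} {x = x} {g = g} {f = f} x∉Y
  rewrite lookup-star {Y = Y} {g = g} {f = f} x | x∉Y = refl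

star-[]≔-inside : ∀ Y (g f : Point n) x → lookup Y x ≡ true →
                  star Y g (f [ x ]≔ b) ≡ star Y g f [ x ]≔ b
star-[]≔-inside {b = b} Y g f x x∈Y = ≡-[]≔ {v = star Y g f} at-x off-x
  where
  at-x : lookup (star Y g (f [ x ]≔ b)) x ≡ b
  at-x = trans (lookup-star-inside {Y = Y} {x = x} {g = g} {f = f [ x ]≔ b} x∈Y) (lookup∘update x f b)

  off-x : ∀ {i} → i ≢ x → lookup (star Y g (f [ x ]≔ b)) i ≡ lookup (star Y g f) i
  off-x {i} i≢x rewrite lookup-star {Y = Y} {g = g} {f = f [ x ]≔ b} i
                      | lookup-star {Y = Y} {g = g} {f = f} i
                      | lookup∘update′ i≢x f b = refl

star-[]≔-outside : ∀ Y (g f : Point n) x → lookup Y x ≡ false →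
                   star Y (g [ x ]≔ b) f ≡ star Y g f [ x ]≔ b
star-[]≔-outside {b = b} Y g f x x∉Y = ≡-[]≔ {v = star Y g f} at-x off-x
  where
  at-x : lookup (star Y (g [ x ]≔ b) f) x ≡ b
  at-x = trans (lookup-star-outside {Y = Y} {x = x} {g = g [ x ]≔ b} {f = f} x∉Y) (lookup∘update x g b)

  off-x : ∀ {i} → i ≢ x → lookup (star Y (g [ x ]≔ b) f) i ≡ lookup (star Y g f) i
  off-x {i} i≢x rewrite lookup-star {Y = Y} {g = g [ x ]≔ b} {f = f} i
                      | lookup-star {Y = Y} {g = g} {f = f} i
                      | lookup∘update′ i≢x g b = refl

star-self-≤ : star Y Y f ≤ₚ Y
star-self-≤ {Y = Y} {f = f} i rewrite lookup-star {Y = Y} {g = Y} {f = f} i with lookup Y i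
... | true  = ≤-maximum _
... | false = ≤-refl

≤-star-self : Y ≤ₚ star Y g Y
≤-star-self {Y = Y} {g = g} i rewrite lookup-star {Y = Y} {g = g} {f = Y} i with lookup Y i
... | true  = ≤-refl
... | false = ≤-minimum _

-- The down-shift on one fibre

-- Together with ∈-down-[]≔⇔ this is the paper's definition of D_x: on the fibre
-- {u[x≔0], u[x≔1]}, the lower point is kept iff some point of the fibre is in S,
-- the upper one iff both are.
FibreCondition : Bool → (Bool → Set) → Set
FibreCondition false P = ∃ P
FibreCondition true  P = ∀ b → P b

FibreCondition⇒∃≥ : ∀ {P} → FibreCondition c P → ∃[ b ] c ≤ b × P b
FibreCondition⇒∃≥ {false} (b , p) = b , ≤-minimum b , p
FibreCondition⇒∃≥ {true}  p       = true , b≤b , p true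

∀⇒FibreCondition : ∀ {P} → (∀ b → P b) → FibreCondition c P
∀⇒FibreCondition {false} p = false , p false
∀⇒FibreCondition {true}  p = p

FibreCondition-map : ∀ {P R} → (∀ {b} → P b → R b) → FibreCondition c P → FibreCondition c R
FibreCondition-map {false} h (b , p) = b , h p
FibreCondition-map {true}  h p       = h ∘ p

∨-≡-true⁻ : ∀ {a a′} → a ∨ a′ ≡ true → a ≡ true ⊎ a′ ≡ true
∨-≡-true⁻ {true}  _ = inj₁ refl
∨-≡-true⁻ {false} p = inj₂ p

∈-down-[]≔⇔ : ∀ x T (u : Point n) c →
              (u [ x ]≔ c) ∈S down x T ⇔ FibreCondition c (λ b → (u [ x ]≔ b) ∈S T)
∈-down-[]≔⇔ x T u false
  rewrite lookup∘update x u false | []≔-idempotent {x = false} {true} u x = mk⇔ some-in some-in⁻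
  where
  some-in : T (u [ x ]≔ false) ∨ T (u [ x ]≔ true) ≡ true → ∃[ b ] (u [ x ]≔ b) ∈S T
  some-in p with ∨-≡-true⁻ p
  ... | inj₁ q = false , q
  ... | inj₂ q = true , q

  some-in⁻ : ∃[ b ] (u [ x ]≔ b) ∈S T → T (u [ x ]≔ false) ∨ T (u [ x ]≔ true) ≡ true
  some-in⁻ (false , q) = cong (_∨ T (u [ x ]≔ true)) q
  some-in⁻ (true  , q) = trans (cong (T (u [ x ]≔ false) ∨_) q) (∨-zeroʳ _)
∈-down-[]≔⇔ x T u true
  rewrite lookup∘update x u true | []≔-idempotent {x = true} {false} u x = mk⇔ both-in both-in⁻
  where
  both-in : T (u [ x ]≔ true) ∧ T (u [ x ]≔ false) ≡ true → ∀ b → (u [ x ]≔ b) ∈S T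
  both-in p false = ∧-conicalʳ _ _ p
  both-in p true  = ∧-conicalˡ _ _ p

  both-in⁻ : (∀ b → (u [ x ]≔ b) ∈S T) → T (u [ x ]≔ true) ∧ T (u [ x ]≔ false) ≡ true
  both-in⁻ h = cong₂ _∧_ (h true) (h false)

∈-down⇔ : ∀ x T (u : Point n) →
          u ∈S down x T ⇔ FibreCondition (lookup u x) (λ b → (u [ x ]≔ b) ∈S T)
∈-down⇔ x T u =
  subst (λ v → v ∈S down x T ⇔ FibreCondition (lookup u x) (λ b → (u [ x ]≔ b) ∈S T))
        ([]≔-lookup u x) (∈-down-[]≔⇔ x T u (lookup u x))

∀-fibre⇒∈ : ∀ x T (u : Point n) → (∀ b → (u [ x ]≔ b) ∈S T) → u ∈S T
∀-fibre⇒∈ x T u h = subst (_∈S T) ([]≔-lookup u x) (h (lookup u x))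

∀-fibre⇒∈-down : ∀ x T (u : Point n) → (∀ b → (u [ x ]≔ b) ∈S T) → u ∈S down x T
∀-fibre⇒∈-down x T u h = from (∈-down⇔ x T u) (∀⇒FibreCondition h)

[]≔true-∈-down⇒∀-fibre : ∀ x T (u : Point n) →
                         (u [ x ]≔ true) ∈S down x T → ∀ b → (u [ x ]≔ b) ∈S T
[]≔true-∈-down⇒∀-fibre x T u = to (∈-down-[]≔⇔ x T u true)

∈⇒[]≔false-∈-down : ∀ x T (u : Point n) → u ∈S T → (u [ x ]≔ false) ∈S down x T
∈⇒[]≔false-∈-down x T u u∈T =
  from (∈-down-[]≔⇔ x T u false) (lookup u x , subst (_∈S T) (sym ([]≔-lookup u x)) u∈T)

∈-down⇒∃≥ : ∀ x T (u : Point n) →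
            u ∈S down x T → ∃[ b ] lookup u x ≤ b × (u [ x ]≔ b) ∈S T
∈-down⇒∃≥ x T u p = FibreCondition⇒∃≥ (to (∈-down⇔ x T u) p)

≤-∈-down⇒≤-∈ : ∀ x T (u : Point n) →
               ∃[ v ] u ≤ₚ v × v ∈S down x T → ∃[ v ] u ≤ₚ v × v ∈S T
≤-∈-down⇒≤-∈ x T u (v , u≤v , p) with ∈-down⇒∃≥ x T v p
... | b , v≤b , q =
  v [ x ]≔ b ,
  subst (_≤ₚ v [ x ]≔ b) ([]≔-lookup u x) (≤ₚ-[]≔ {w = u} {u = v} {k = x} u≤v (≤-trans (u≤v x) v≤b)) ,
  q

applyShifts-++ : ∀ (L R : List (Fin n)) T → applyShifts (L ++ R) T ≡ applyShifts R (applyShifts L T)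
applyShifts-++ []      R T = refl
applyShifts-++ (x ∷ L) R T = applyShifts-++ L R (down x T)

applyShifts-preserves : (P : System n → Set) → ∀ Q → (∀ {x T} → x ∈ Q → P T → P (down x T)) →
                        ∀ {T} → P T → P (applyShifts Q T)
applyShifts-preserves P []      pres p = p
applyShifts-preserves P (x ∷ Q) pres p =
  applyShifts-preserves P Q (pres ∘ there) (pres (here refl) p)

applyShifts-reflects : (P : System n → Set) → ∀ Q → (∀ {x T} → P (down x T) → P T) →
                       ∀ {T} → P (applyShifts Q T) → P T
applyShifts-reflects P []      back p = p
applyShifts-reflects P (x ∷ Q) back p = back (applyShifts-reflects P Q back p)

-- Down-closedness and heredity

DownClosedIn : Fin n → System n → Set
DownClosedIn x T = ∀ u → u ∈S T → (u [ x ]≔ false) ∈S T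

down-downClosedIn : ∀ x (T : System n) → DownClosedIn x (down x T)
down-downClosedIn x T u p with ∈-down⇒∃≥ x T u p
... | b , _ , q =
  subst (_∈S down x T) ([]≔-idempotent u x) (∈⇒[]≔false-∈-down x T (u [ x ]≔ b) q)

-- Clearing x commutes with the y-fibres, and D_y is monotone on each fibre.
down-preserves-downClosedIn : ∀ x y (T : System n) →
                              DownClosedIn x T → DownClosedIn x (down y T)
down-preserves-downClosedIn x y T closed u p with y ≟ x
... | yes refl = down-downClosedIn x T u p
... | no y≢x   =
  from (∈-down⇔ y T (u [ x ]≔ false))
       (subst (λ c → FibreCondition c (λ b → ((u [ x ]≔ false) [ y ]≔ b) ∈S T))
              (sym (lookup∘update′ y≢x u false))
              (FibreCondition-map clear (to (∈-down⇔ y T u) p)))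
  where
  clear : ∀ {b} → (u [ y ]≔ b) ∈S T → ((u [ x ]≔ false) [ y ]≔ b) ∈S T
  clear {b} q = subst (_∈S T) ([]≔-commutes u y x y≢x) (closed (u [ y ]≔ b) q)

applyShifts-downClosedIn : ∀ {x} Q (T : System n) → x ∈ Q → DownClosedIn x (applyShifts Q T)
applyShifts-downClosedIn {x = x} (y ∷ Q) T (here refl) =
  applyShifts-preserves (DownClosedIn x) Q (λ {y} {T} _ → down-preserves-downClosedIn x y T)
                        (down-downClosedIn x T)
applyShifts-downClosedIn (y ∷ Q) T (there x∈Q) = applyShifts-downClosedIn Q (down y T) x∈Q

downClosedIn-lower : ∀ {x} {T : System n} u → DownClosedIn x T → b ≤ c →
                     (u [ x ]≔ c) ∈S T → (u [ x ]≔ b) ∈S T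
downClosedIn-lower u closed b≤b p = p
downClosedIn-lower {x = x} {T} u closed f≤t p = subst (_∈S T) ([]≔-idempotent u x) (closed _ p)

downClosed⇒≤-∈ : ∀ K {T : System n} {w u} → (∀ {x} → x ∈ K → DownClosedIn x T) →
                  w ≤ₚ u → AgreeOutside K w u → u ∈S T → w ∈S T
downClosed⇒≤-∈ [] {T} _ _ agree p = subst (_∈S T) (sym (agreeOutside-[] agree)) p
downClosed⇒≤-∈ (k ∷ K) {T} {w} {u} closed w≤u agree p =
  subst (_∈S T) ([]≔-lookup w k)
    (downClosed⇒≤-∈ K (closed ∘ there)
       (≤ₚ-[]≔ {w = w} {u = u} {k = k} w≤u ≤-refl)
       (agreeOutside-[]≔ {w = w} {u = u} {b = lookup w k} agree)
       (downClosedIn-lower u (closed (here refl)) (w≤u k) (subst (_∈S T) (sym ([]≔-lookup u k)) p)))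

Hereditary : System n → Set
Hereditary T = ∀ {w u} → w ≤ₚ u → u ∈S T → w ∈S T

fullShift-hereditary : ∀ {Q} (T : System n) → FShift n Q → Hereditary (applyShifts Q T)
fullShift-hereditary {n} {Q} T full w≤u =
  downClosed⇒≤-∈ (allFin n)
    (λ {x} _ → applyShifts-downClosedIn Q T (∈-resp-↭ (↭-sym full) (∈-allFin x)))
    w≤u (λ i → inj₂ (∈-allFin i))

hereditary-∈⇒stronglyShatters : Hereditary T → Y ∈S T → StronglyShatters T Y
hereditary-∈⇒stronglyShatters {Y = Y} hered Y∈T = Y , λ f → hered (star-self-≤ {Y = Y} {f = f}) Y∈T

hereditary-stronglyShatters⇒∈ : Hereditary T → StronglyShatters T Y → Y ∈S T
hereditary-stronglyShatters⇒∈ {Y = Y} hered (g , h) = hered (≤-star-self {Y = Y} {g = g}) (h Y)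

-- Shattering under shifts

stronglyShatters⇒shatters : StronglyShatters T Y → Shatters T Y
stronglyShatters⇒shatters (g , h) f = g , h f

down-shatters⇒shatters : ∀ x (T : System n) → Shatters (down x T) Y → Shatters T Y
down-shatters⇒shatters {Y = Y} x T shattered f with lookup Y x in x∈?Y
... | false with shattered f
...   | g , p with ∈-down⇒∃≥ x T (star Y g f) p
...     | b , _ , q = g [ x ]≔ b , subst (_∈S T) (sym (star-[]≔-outside Y g f x x∈?Y)) q
down-shatters⇒shatters {Y = Y} x T shattered f | true with shattered (f [ x ]≔ true)
... | g , p =
  g , ∀-fibre⇒∈ x T (star Y g f)
        ([]≔true-∈-down⇒∀-fibre x T (star Y g f)
           (subst (_∈S down x T) (star-[]≔-inside Y g f x x∈?Y) p))

shatters⇒down-shatters : ∀ x (T : System n) → lookup Y x ≡ false →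
                         Shatters T Y → Shatters (down x T) Y
shatters⇒down-shatters {Y = Y} x T x∉Y shattered f with shattered f
... | g , p =
  g [ x ]≔ false ,
  subst (_∈S down x T) (sym (star-[]≔-outside Y g f x x∉Y)) (∈⇒[]≔false-∈-down x T (star Y g f) p)

stronglyShatters⇒down-stronglyShatters : ∀ x (T : System n) →
                                         StronglyShatters T Y → StronglyShatters (down x T) Y
stronglyShatters⇒down-stronglyShatters {Y = Y} x T (g , h) with lookup Y x in x∈?Y
... | true  = g , λ f →
  ∀-fibre⇒∈-down x T (star Y g f) (λ b → subst (_∈S T) (star-[]≔-inside Y g f x x∈?Y) (h (f [ x ]≔ b)))
... | false = g [ x ]≔ false , λ f →
  subst (_∈S down x T) (sym (star-[]≔-outside Y g f x x∈?Y)) (∈⇒[]≔false-∈-down x T (star Y g f) (h f))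

module _ (Y : Subset n) where

  private
    _∈Y? : ∀ i → Dec (lookup Y i ≡ true)
    i ∈Y? = lookup Y i ≟ᵇ true

  inside outside : List (Fin n)
  inside  = filter _∈Y? (allFin n)
  outside = filter (∁? _∈Y?) (allFin n)

  allFin-↭-inside++outside : allFin n ↭ inside ++ outside
  allFin-↭-inside++outside =
    subst (λ { (ys , zs) → allFin n ↭ ys ++ zs }) (partition-defn _∈Y? (allFin n))
          (↭ₛ⇒↭ (↭ₛ.partition-↭ (setoid (Fin n)) _∈Y? (allFin n)))

  ∈-inside⁺ : lookup Y x ≡ true → x ∈ inside
  ∈-inside⁺ {x = x} = ∈-filter⁺ _∈Y? (∈-allFin x)

  ∈-inside⁻ : x ∈ inside → lookup Y x ≡ true
  ∈-inside⁻ x∈inside = proj₂ (∈-filter⁻ _∈Y? {xs = allFin n} x∈inside)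

  ∈-outside⁺ : lookup Y x ≡ false → x ∈ outside
  ∈-outside⁺ {x = x} x∉Y = ∈-filter⁺ (∁? _∈Y?) (∈-allFin x) (not-¬ x∉Y)

  ∈-outside⁻ : x ∈ outside → lookup Y x ≡ false
  ∈-outside⁻ x∈outside = ¬-not (proj₂ (∈-filter⁻ (∁? _∈Y?) {xs = allFin n} x∈outside))

star-agreeOutside-inside : ∀ Y (g f : Point n) → AgreeOutside (inside Y) (star Y g f) g
star-agreeOutside-inside Y g f i with lookup Y i in i∈?Y
... | true  = inj₂ (∈-inside⁺ Y i∈?Y)
... | false = inj₁ (lookup-star-outside {Y = Y} {x = i} {g = g} {f = f} i∈?Y)

star-agreeOutside-outside : ∀ Y (g g′ f : Point n) →
                            AgreeOutside (outside Y) (star Y g f) (star Y g′ f)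
star-agreeOutside-outside Y g g′ f i with lookup Y i in i∈?Y
... | true  = inj₁ (trans (lookup-star-inside {Y = Y} {x = i} {g = g} {f = f} i∈?Y)
                          (sym (lookup-star-inside {Y = Y} {x = i} {g = g′} {f = f} i∈?Y)))
... | false = inj₂ (∈-outside⁺ Y i∈?Y)

star-self-≤-star : ∀ Y (g f : Point n) → star Y Y f ≤ₚ star Y g f
star-self-≤-star Y g f i
  rewrite lookup-star {Y = Y} {g = Y} {f = f} i | lookup-star {Y = Y} {g = g} {f = f} i
  with lookup Y i
... | true  = ≤-refl
... | false = ≤-minimum _

stronglyShatters⇒applyShifts-stronglyShatters : ∀ Q {T : System n} → StronglyShatters T Y →
                                                StronglyShatters (applyShifts Q T) Y
stronglyShatters⇒applyShifts-stronglyShatters {Y = Y} Q =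
  applyShifts-preserves (λ T → StronglyShatters T Y) Q
    (λ {x} {T} _ → stronglyShatters⇒down-stronglyShatters {Y = Y} x T)

shatters-downClosedOutside⇒stronglyShatters : (∀ {x} → x ∈ outside Y → DownClosedIn x T) →
                                               Shatters T Y → StronglyShatters T Y
shatters-downClosedOutside⇒stronglyShatters {Y = Y} closed shattered = Y , λ f →
  let g , p = shattered f in
  downClosed⇒≤-∈ (outside Y) closed (star-self-≤-star Y g f) (star-agreeOutside-outside Y Y g f) p

∈-applyShifts⇒agreeOutside-∈ : ∀ L (T : System n) {v w} → v ∈S applyShifts L T →
                                 (∀ {x} → x ∈ L → lookup v x ≡ true) → AgreeOutside L w v → w ∈S T
∈-applyShifts⇒agreeOutside-∈ [] T p _ agree = subst (_∈S T) (sym (agreeOutside-[] agree)) p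
∈-applyShifts⇒agreeOutside-∈ (x ∷ L) T {v} {w} p saturated agree =
  ∀-fibre⇒∈ x T w ([]≔true-∈-down⇒∀-fibre x T w
    (∈-applyShifts⇒agreeOutside-∈ L (down x T) {v} {w [ x ]≔ true} p (saturated ∘ there) agree′))
  where
  agree′ : AgreeOutside L (w [ x ]≔ true) v
  agree′ = subst (AgreeOutside L (w [ x ]≔ true)) ([]≔-self {u = v} {x = x} (saturated (here refl)))
                 (agreeOutside-[]≔ {w = w} {u = v} {b = true} agree)

shatters⇒unionShifts : Shatters S Y → unionShifts S Y
shatters⇒unionShifts {S = S} {Y = Y} shattered =
  outside Y ++ inside Y , full ,
  hereditary-stronglyShatters⇒∈ {T = applyShifts (outside Y ++ inside Y) S} (fullShift-hereditary S full)
    (subst (λ T → StronglyShatters T Y) (sym (applyShifts-++ (outside Y) (inside Y) S))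
       (stronglyShatters⇒applyShifts-stronglyShatters {Y = Y} (inside Y) stronglyShattered₀))
  where
  full : FShift _ (outside Y ++ inside Y)
  full = ↭-trans (++-comm (outside Y) (inside Y)) (↭-sym (allFin-↭-inside++outside Y))

  shattered₀ : Shatters (applyShifts (outside Y) S) Y
  shattered₀ = applyShifts-preserves (λ T → Shatters T Y) (outside Y)
    (λ {x} {T} x∈outside → shatters⇒down-shatters {Y = Y} x T (∈-outside⁻ Y x∈outside)) shattered

  stronglyShattered₀ : StronglyShatters (applyShifts (outside Y) S) Y
  stronglyShattered₀ =
    shatters-downClosedOutside⇒stronglyShatters {Y = Y} (applyShifts-downClosedIn (outside Y) S) shattered₀

unionShifts⇒shatters : unionShifts S Y → Shatters S Y
unionShifts⇒shatters {S = S} {Y = Y} (Q , full , Y∈QS) =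
  applyShifts-reflects (λ T → Shatters T Y) Q (λ {x} {T} → down-shatters⇒shatters {Y = Y} x T)
    (stronglyShatters⇒shatters {T = applyShifts Q S} {Y = Y}
       (hereditary-∈⇒stronglyShatters {T = applyShifts Q S} (fullShift-hereditary S full) Y∈QS))

stronglyShatters⇒interShifts : StronglyShatters S Y → interShifts S Y
stronglyShatters⇒interShifts {S = S} {Y = Y} stronglyShattered Q full =
  hereditary-stronglyShatters⇒∈ {T = applyShifts Q S} (fullShift-hereditary S full)
    (stronglyShatters⇒applyShifts-stronglyShatters {Y = Y} Q stronglyShattered)

interShifts⇒stronglyShatters : interShifts S Y → StronglyShatters S Y
interShifts⇒stronglyShatters {S = S} {Y = Y} Y∈⋂ =
  witness (applyShifts-reflects (λ T → ∃[ v ] Y ≤ₚ v × v ∈S T) (outside Y)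
             (λ {x} {T} → ≤-∈-down⇒≤-∈ x T Y) (Y , (λ _ → ≤-refl) , Y∈QS))
  where
  Y∈QS : Y ∈S applyShifts (outside Y) (applyShifts (inside Y) S)
  Y∈QS = subst (λ T → Y ∈S T) (applyShifts-++ (inside Y) (outside Y) S)
               (Y∈⋂ (inside Y ++ outside Y) (↭-sym (allFin-↭-inside++outside Y)))

  witness : ∃[ v ] Y ≤ₚ v × v ∈S applyShifts (inside Y) S → StronglyShatters S Y
  witness (v , Y≤v , v∈) = v , λ f →
    ∈-applyShifts⇒agreeOutside-∈ (inside Y) S v∈
      (λ x∈inside → ≤ₚ-true {u = Y} {v = v} Y≤v (∈-inside⁻ Y x∈inside))
      (star-agreeOutside-inside Y v f)

∈⇔inSet : ∀ (T : SystemP n) Y → T Y ⇔ InSet T Y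
∈⇔inSet T Y = mk⇔ (λ Y∈T → Y , Y∈T , tabulate∘lookup Y)
                  (λ { (f , f∈T , ones-f≡Y) → subst T (trans (sym (tabulate∘lookup f)) ones-f≡Y) f∈T })

mainTheorem3 : ∀ (n : ℕ) (S : System n) →
    (∀ (Y : Subset n) → (Shatters S Y ⇔ InSet (unionShifts S) Y))
    × (∀ (Y : Subset n) → (StronglyShatters S Y ⇔ InSet (interShifts S) Y))
mainTheorem3 n S =
  (λ Y → ⇔-trans (mk⇔ shatters⇒unionShifts unionShifts⇒shatters)
                 (∈⇔inSet (unionShifts S) Y)) ,
  (λ Y → ⇔-trans (mk⇔ stronglyShatters⇒interShifts interShifts⇒stronglyShatters)
                 (∈⇔inSet (interShifts S) Y))
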